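{- The following four statements are pairwise equivalent: (A) For every finite GCD-closed set $\mathcal{N}\subseteq\mathbb{N}^+$ with at least two elements, there exist a prime $p$ and an integer $k\ge1$ such that $p^k$ divides at least one member of $\mathcal{N}$ and $\#\{n\in\mathcal{N}: p^k\mid n\}\le\tfrac12\#\mathcal{N}$. (B) (Intersection-closed sets conjecture) For every finite intersection-closed family $\mathcal{S}$ of finite sets with at least two members, there exists an element $x\in\bigcup\mathcal{S}$ such that $\#\{A\in\mathcal{S}: x\in A\}\le\tfrac12\#\mathcal{S}$. (C) (Union-closed sets conjecture) For every finite union-closed family $\mathcal{S}$ of finite sets having at least one nonempty member, there exists an element $x\in\bigcup\mathcal{S}$ such that $\#\{A\in\mathcal{S}: x\in A\}\ge\tfrac12\#\mathcal{S}$. (D) For every finite LCM-closed set $\mathcal{N}\subseteq\mathbb{N}^+$ that contains at least one element different from $1$, there exists an integer $d>1$ such that $\#\{n\in\mathcal{N} : d\mid n\}\ge \tfrac12\#\mathcal{N}$.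
   Context: $\mathbb{N}^+=\{1,2,3,\dots\}$. A nonempty set $\mathcal{N}\subseteq\mathbb{N}^+$ is LCM-closed (resp. GCD-closed) if $m,n\in\mathcal{N}$ implies $\mathrm{lcm}(m,n)\in\mathcal{N}$ (resp. $\gcd(m,n)\in\mathcal{N}$). A family $\mathcal{S}$ of sets is union-closed (resp. intersection-closed) if $A,B\in\mathcal{S}$ implies $A\cup B\in\mathcal{S}$ (resp. $A\cap B\in\mathcal{S}$). -}

module Defs where

open import Data.Nat using (ℕ; suc; _≤_; _<_; _*_; _^_; NonZero)
open import Data.Nat.GCD using (gcd)
open import Data.Nat.LCM using (lcm)
open import Data.Nat.Divisibility using (_∣_; _∣?_)
open import Data.Nat.Primality using (Prime)
open import Data.List using (List; length; filter)
open import Data.List.Membership.Propositional renaming (_∈_ to _∈L_)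
open import Data.List.Relation.Unary.All using (All)
open import Data.List.Relation.Unary.Unique.Propositional using (Unique)
open import Data.Fin using (Fin)
open import Data.Fin.Subset using (Subset; _∈_; _∪_; _∩_; Nonempty)
open import Data.Fin.Subset.Properties using (_∈?_)
open import Data.Product using (_×_; ∃; ∃-syntax; Σ-syntax)
open import Function.Bundles using (_⇔_)
open import Relation.Binary.PropositionalEquality using (_≢_)

record FinSetℕ⁺ : Set where
  constructor mkFinSetℕ⁺
  field
    elems    : List ℕ
    unique   : Unique elems
    positive : All NonZero elems
open FinSetℕ⁺ public

GCDClosed : FinSetℕ⁺ → Set
GCDClosed N = ∀ {m n} → m ∈L elems N → n ∈L elems N → gcd m n ∈L elems N

LCMClosed : FinSetℕ⁺ → Set
LCMClosed N = ∀ {m n} → m ∈L elems N → n ∈L elems N → lcm m n ∈L elems N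

countDiv : ℕ → FinSetℕ⁺ → ℕ
countDiv d N = length (filter (d ∣?_) (elems N))

-- A finite family of finite sets. Ground sets are taken WLOG to be Fin u
-- (any finite family of finite sets lives inside a finite universe).
record Family (u : ℕ) : Set where
  constructor mkFamily
  field
    members : List (Subset u)
    distinct : Unique members
open Family public

UnionClosed : ∀ {u} → Family u → Set
UnionClosed S = ∀ {A B} → A ∈L members S → B ∈L members S → (A ∪ B) ∈L members S

IntersectionClosed : ∀ {u} → Family u → Set
IntersectionClosed S = ∀ {A B} → A ∈L members S → B ∈L members S → (A ∩ B) ∈L members S

_∈⋃_ : ∀ {u} → Fin u → Family u → Set
x ∈⋃ S = ∃[ A ] (A ∈L members S × x ∈ A)

countMem : ∀ {u} → Fin u → Family u → ℕ
countMem x S = length (filter (x ∈?_) (members S))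

#_ : ∀ {u} → Family u → ℕ
# S = length (members S)

StmtA : Set
StmtA = ∀ (N : FinSetℕ⁺) → GCDClosed N → 2 ≤ length (elems N) →
  ∃[ p ] ∃[ k ] (Prime p × 1 ≤ k
     × (∃[ n ] (n ∈L elems N × p ^ k ∣ n))
     × 2 * countDiv (p ^ k) N ≤ length (elems N))

StmtB : Set
StmtB = ∀ (u : ℕ) (S : Family u) → IntersectionClosed S → 2 ≤ # S →
  ∃[ x ] (x ∈⋃ S × 2 * countMem x S ≤ # S)

StmtC : Set
StmtC = ∀ (u : ℕ) (S : Family u) → UnionClosed S →
  (∃[ A ] (A ∈L members S × Nonempty A)) →
  ∃[ x ] (x ∈⋃ S × # S ≤ 2 * countMem x S)

StmtD : Set
StmtD = ∀ (N : FinSetℕ⁺) → LCMClosed N →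
  (∃[ n ] (n ∈L elems N × n ≢ 1)) →
  ∃[ d ] (1 < d × length (elems N) ≤ 2 * countDiv d N)

-- B ⇔ C: replace each member A by its complement U ─ A in U = ⋃ S (De Morgan).
--   B ⇒ A, C ⇒ D: encode n as the set of prime powers dividing it; this turns
--     gcd into ∩ and lcm into ∪, and is injective by prime-power separation
--     (m ∣ n as soon as every prime power dividing m divides n).
--   A ⇒ B, D ⇒ C: code A ⊆ Fin u as the squarefree product of the primes π x,
--     x ∈ A, for an injective prime sequence π; this turns ∩ into gcd and ∪ into lcm.
module Submission where

open import Defs
open import Level using (Level)
open import Data.Bool.Properties using () renaming (_≟_ to _≟ᵇ_)
open import Data.Fin using (Fin; zero; suc; toℕ; fromℕ<)
open import Data.Fin.Properties using (toℕ-injective; toℕ-fromℕ<)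
import Data.Fin.Properties as Fin
open import Data.Fin.Subset using (Subset; _∈_; _∉_; _⊆_; _∪_; _∩_; _─_; ⋃; Nonempty; inside; outside)
open import Data.Fin.Subset.Properties using (_∈?_; ⊆-antisym; x∈p∪q⁺; x∈p∪q⁻; x∈p∩q⁺; x∈p∩q⁻; x∈p∧x∉q⇒x∈p─q; nonempty?; ∉⊥)
open import Data.List using (List; []; _∷_; length; filter; map)
open import Data.List.Membership.Propositional using () renaming (_∈_ to _∈ₗ_)
open import Data.List.Membership.Propositional.Properties using (∈-map⁺; ∈-map⁻)
open import Data.List.Properties using (length-map)
open import Data.List.Relation.Unary.Any using (here; there)
open import Data.List.Relation.Unary.All as All using ([]; _∷_)
open import Data.List.Relation.Unary.All.Properties as All using ()
open import Data.List.Relation.Unary.AllPairs using ([]; _∷_)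
open import Data.List.Relation.Unary.Unique.Propositional using (Unique)
open import Data.Nat using (ℕ; zero; suc; _+_; _*_; _^_; _!; _≤_; _<_; z≤n; s≤s; _≤?_; _≟_; NonZero; nonTrivial⇒n>1; ≢-nonZero; ≢-nonZero⁻¹; >-nonZero⁻¹)
open import Data.Nat.Properties
open import Data.Nat.Divisibility
open import Data.Nat.GCD using (gcd; gcd-greatest; gcd[m,n]∣m; gcd[m,n]∣n; gcd[m,n]≢0)
open import Data.Nat.Induction using (<-rec)
open import Data.Nat.ListAction using (product)
open import Data.Nat.ListAction.Properties using (∈⇒∣product; product≢0)
open import Data.Nat.LCM using (lcm; lcm-least; m∣lcm[m,n]; n∣lcm[m,n])
open import Data.Nat.Primality using (Prime; prime?; euclidsLemma; ¬prime[1]; prime⇒nonZero; prime⇒nonTrivial; prime⇒irreducible)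
open import Data.Nat.Primality.Factorisation using (factorise)
open import Relation.Binary.Definitions using (tri<; tri≈; tri>)
open import Data.Product using (_×_; _,_; proj₁; proj₂; ∃-syntax)
open import Data.Sum as Sum using (_⊎_; inj₁; inj₂; [_,_])
open import Data.Vec as Vec using ([]; _∷_)
open import Data.Vec.Properties using (≡-dec)
open import Function using (_∘_)
open import Function.Bundles using (_⇔_; mk⇔; Equivalence)
open import Relation.Nullary using (¬_; yes; no; does; contradiction)
open import Relation.Nullary.Decidable using (map′; _×-dec_)
open import Relation.Unary using (Pred; Decidable)
open import Relation.Unary.Properties using (∁?)
open import Relation.Binary.PropositionalEquality using (_≡_; _≢_; refl; sym; trans; cong; subst; subst₂; module ≡-Reasoning)

private variable
  ℓ ℓ′ : Level
  X Y : Set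

-- Counting in lists

count : {P : Pred X ℓ} → Decidable P → List X → ℕ
count P? xs = length (filter P? xs)

count-map : {P : Pred Y ℓ} {Q : Pred X ℓ′} (P? : Decidable P) (Q? : Decidable Q) (f : X → Y) →
  ∀ xs → (∀ {x} → x ∈ₗ xs → P (f x) ⇔ Q x) → count P? (map f xs) ≡ count Q? xs
count-map P? Q? f [] _ = refl
count-map P? Q? f (x ∷ xs) P⇔Q with P? (f x) | Q? x
... | yes _ | yes _ = cong suc (count-map P? Q? f xs (λ x∈ → P⇔Q (there x∈)))
... | no _ | no _ = count-map P? Q? f xs (λ x∈ → P⇔Q (there x∈))
... | yes Pfx | no ¬Qx = contradiction (Equivalence.to (P⇔Q (here refl)) Pfx) ¬Qx
... | no ¬Pfx | yes Qx = contradiction (Equivalence.from (P⇔Q (here refl)) Qx) ¬Pfx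

count-complement : {P : Pred X ℓ} (P? : Decidable P) →
  ∀ xs → count P? xs + count (∁? P?) xs ≡ length xs
count-complement P? [] = refl
count-complement P? (x ∷ xs) with P? x
... | yes _ = cong suc (count-complement P? xs)
... | no _ = trans (+-suc _ _) (cong suc (count-complement P? xs))

count-mono : {P : Pred X ℓ} {Q : Pred X ℓ′} (P? : Decidable P) (Q? : Decidable Q) →
  ∀ xs → (∀ {x} → x ∈ₗ xs → P x → Q x) → count P? xs ≤ count Q? xs
count-mono P? Q? [] _ = z≤n
count-mono P? Q? (x ∷ xs) P⇒Q with P? x | Q? x
... | yes _ | yes _ = s≤s (count-mono P? Q? xs (λ x∈ → P⇒Q (there x∈)))
... | no _ | no _ = count-mono P? Q? xs (λ x∈ → P⇒Q (there x∈))
... | no _ | yes _ = m≤n⇒m≤1+n (count-mono P? Q? xs (λ x∈ → P⇒Q (there x∈)))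
... | yes Px | no ¬Qx = contradiction (P⇒Q (here refl) Px) ¬Qx

count-witness : {P : Pred X ℓ} (P? : Decidable P) →
  ∀ xs → 1 ≤ count P? xs → ∃[ x ] (x ∈ₗ xs × P x)
count-witness P? (x ∷ xs) pos with P? x
... | yes Px = x , here refl , Px
... | no _ = let (y , y∈ , Py) = count-witness P? xs pos in y , there y∈ , Py

count-positive : {P : Pred X ℓ} (P? : Decidable P) →
  ∀ {x} xs → x ∈ₗ xs → P x → 1 ≤ count P? xs
count-positive P? (y ∷ xs) x∈ Px with P? y | x∈
... | yes _ | _ = s≤s z≤n
... | no ¬Py | here refl = contradiction Px ¬Py
... | no _ | there x∈xs = count-positive P? xs x∈xs Px

unique-map : (f : X → Y) {xs : List X} →
  (∀ {x y} → x ∈ₗ xs → y ∈ₗ xs → f x ≡ f y → x ≡ y) → Unique xs → Unique (map f xs)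
unique-map f {[]} _ [] = []
unique-map f {x ∷ xs} inj (x∉xs ∷ uniq) =
  All.map⁺ (All.tabulate λ y∈ fx≡fy → All.lookup x∉xs y∈ (inj (here refl) (there y∈) fx≡fy))
  ∷ unique-map f (λ x∈ y∈ → inj (there x∈) (there y∈)) uniq

member⇒1≤length : ∀ {x : X} {xs} → x ∈ₗ xs → 1 ≤ length xs
member⇒1≤length {xs = _ ∷ _} _ = s≤s z≤n

two-distinct : (xs : List X) → Unique xs → 2 ≤ length xs → ∃[ x ] ∃[ y ] (x ∈ₗ xs × y ∈ₗ xs × x ≢ y)
two-distinct (x ∷ y ∷ _) ((x≢y ∷ _) ∷ _) _ = x , y , here refl , there (here refl) , x≢y
two-distinct (_ ∷ []) _ (s≤s ())

map-closed : (f : X → Y) {_∙_ : X → X → X} {_◦_ : Y → Y → Y} {xs : List X} →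
  (∀ {x y} → x ∈ₗ xs → y ∈ₗ xs → (x ∙ y) ∈ₗ xs) → (∀ x y → f x ◦ f y ≡ f (x ∙ y)) →
  ∀ {c d} → c ∈ₗ map f xs → d ∈ₗ map f xs → (c ◦ d) ∈ₗ map f xs
map-closed f {xs = xs} closed hom c∈ d∈ with ∈-map⁻ f c∈ | ∈-map⁻ f d∈
... | x , x∈ , refl | y , y∈ , refl = subst (_∈ₗ map f xs) (sym (hom x y)) (∈-map⁺ f (closed x∈ y∈))

half-complement : ∀ {x y n} → x + y ≡ n → (2 * x ≤ n) ⇔ (n ≤ 2 * y)
half-complement {x} {y} {n} x+y≡n = mk⇔
  (λ 2x≤n → +-cancelˡ-≤ n n (2 * y) (≤-trans (≤-reflexive (sym doubled)) (+-monoˡ-≤ (2 * y) 2x≤n)))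
  (λ n≤2y → +-cancelʳ-≤ n (2 * x) n (≤-trans (+-monoʳ-≤ (2 * x) n≤2y) (≤-reflexive doubled)))
  where
  doubled : 2 * x + 2 * y ≡ n + n
  doubled = trans (sym (*-distribˡ-+ 2 x y)) (trans (cong (2 *_) x+y≡n) (cong (n +_) (+-identityʳ n)))

half-positive : ∀ {n c} → 1 ≤ n → n ≤ 2 * c → 1 ≤ c
half-positive {c = zero} 1≤n n≤0 = contradiction n≤0 (<⇒≱ 1≤n)
half-positive {c = suc c} _ _ = s≤s z≤n

-- Relative complements

x∈p─q⁻ : ∀ {n} (p q : Subset n) {x} → x ∈ p ─ q → x ∈ p × x ∉ q
x∈p─q⁻ (inside ∷ p) (outside ∷ q) Vec.here = Vec.here , λ ()
x∈p─q⁻ (_ ∷ p) (inside ∷ q) {zero} ()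
x∈p─q⁻ (outside ∷ p) (outside ∷ q) {zero} ()
x∈p─q⁻ (_ ∷ p) (_ ∷ q) (Vec.there x∈) =
  let (x∈p , x∉q) = x∈p─q⁻ p q x∈ in Vec.there x∈p , λ { (Vec.there x∈q) → x∉q x∈q }

module _ {n : ℕ} (U : Subset n) where

  de-morgan-∪ : ∀ A B → (U ─ A) ∩ (U ─ B) ≡ U ─ (A ∪ B)
  de-morgan-∪ A B = ⊆-antisym sub sup
    where
    sub : (U ─ A) ∩ (U ─ B) ⊆ U ─ (A ∪ B)
    sub x∈ with x∈p∩q⁻ (U ─ A) (U ─ B) x∈
    ... | x∈U─A , x∈U─B with x∈p─q⁻ U A x∈U─A | x∈p─q⁻ U B x∈U─B
    ...   | x∈U , x∉A | _ , x∉B = x∈p∧x∉q⇒x∈p─q x∈U (λ x∈A∪B → [ x∉A , x∉B ] (x∈p∪q⁻ A B x∈A∪B))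
    sup : U ─ (A ∪ B) ⊆ (U ─ A) ∩ (U ─ B)
    sup x∈ with x∈p─q⁻ U (A ∪ B) x∈
    ... | x∈U , x∉A∪B = x∈p∩q⁺ ( x∈p∧x∉q⇒x∈p─q x∈U (x∉A∪B ∘ x∈p∪q⁺ ∘ inj₁)
                               , x∈p∧x∉q⇒x∈p─q x∈U (x∉A∪B ∘ x∈p∪q⁺ ∘ inj₂))

  de-morgan-∩ : ∀ A B → (U ─ A) ∪ (U ─ B) ≡ U ─ (A ∩ B)
  de-morgan-∩ A B = ⊆-antisym sub sup
    where
    sub : (U ─ A) ∪ (U ─ B) ⊆ U ─ (A ∩ B)
    sub x∈ with x∈p∪q⁻ (U ─ A) (U ─ B) x∈
    ... | inj₁ x∈U─A = let (x∈U , x∉A) = x∈p─q⁻ U A x∈U─A in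
                       x∈p∧x∉q⇒x∈p─q x∈U (x∉A ∘ proj₁ ∘ x∈p∩q⁻ A B)
    ... | inj₂ x∈U─B = let (x∈U , x∉B) = x∈p─q⁻ U B x∈U─B in
                       x∈p∧x∉q⇒x∈p─q x∈U (x∉B ∘ proj₂ ∘ x∈p∩q⁻ A B)
    sup : U ─ (A ∩ B) ⊆ (U ─ A) ∪ (U ─ B)
    sup {x} x∈ with x∈p─q⁻ U (A ∩ B) x∈ | x ∈? A
    ... | x∈U , x∉A∩B | yes x∈A = x∈p∪q⁺ (inj₂ (x∈p∧x∉q⇒x∈p─q x∈U (λ x∈B → x∉A∩B (x∈p∩q⁺ (x∈A , x∈B)))))
    ... | x∈U , _ | no x∉A = x∈p∪q⁺ (inj₁ (x∈p∧x∉q⇒x∈p─q x∈U x∉A))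

  ─-injective : ∀ {A B} → A ⊆ U → B ⊆ U → U ─ A ≡ U ─ B → A ≡ B
  ─-injective A⊆U B⊆U eq = ⊆-antisym (included A⊆U eq) (included B⊆U (sym eq))
    where
    included : ∀ {A B} → A ⊆ U → U ─ A ≡ U ─ B → A ⊆ B
    included {A} {B} A⊆U eq {x} x∈A with x ∈? B
    ... | yes x∈B = x∈B
    ... | no x∉B = contradiction x∈A (proj₂ (x∈p─q⁻ U A (subst (x ∈_) (sym eq) (x∈p∧x∉q⇒x∈p─q (A⊆U x∈A) x∉B))))

  ─-nonempty : ∀ {A} → A ⊆ U → A ≢ U → Nonempty (U ─ A)
  ─-nonempty {A} A⊆U A≢U with nonempty? (U ─ A)
  ... | yes nonempty = nonempty
  ... | no empty = contradiction (⊆-antisym A⊆U U⊆A) A≢U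
    where
    U⊆A : U ⊆ A
    U⊆A {x} x∈U with x ∈? A
    ... | yes x∈A = x∈A
    ... | no x∉A = contradiction (x , x∈p∧x∉q⇒x∈p─q x∈U x∉A) empty

⊆⋃ : ∀ {n} {A : Subset n} xs → A ∈ₗ xs → A ⊆ ⋃ xs
⊆⋃ (B ∷ xs) (here refl) x∈A = x∈p∪q⁺ (inj₁ x∈A)
⊆⋃ (B ∷ xs) (there A∈) x∈A = x∈p∪q⁺ (inj₂ (⊆⋃ xs A∈ x∈A))

⋃⁻ : ∀ {n} {x : Fin n} xs → x ∈ ⋃ xs → ∃[ A ] (A ∈ₗ xs × x ∈ A)
⋃⁻ [] x∈ = contradiction x∈ ∉⊥
⋃⁻ (B ∷ xs) x∈ with x∈p∪q⁻ B (⋃ xs) x∈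
... | inj₁ x∈B = B , here refl , x∈B
... | inj₂ x∈⋃ = let (A , A∈ , x∈A) = ⋃⁻ xs x∈⋃ in A , there A∈ , x∈A

module Complements {u : ℕ} (S : Family u) where

  U : Subset u
  U = ⋃ (members S)

  S̅ : Family u
  S̅ = mkFamily (map (U ─_) (members S))
        (unique-map (U ─_) (λ A∈ B∈ → ─-injective U (⊆⋃ _ A∈) (⊆⋃ _ B∈)) (distinct S))

  size : # S̅ ≡ # S
  size = length-map (U ─_) (members S)

  count-split : ∀ {x} → x ∈ U → countMem x S + countMem x S̅ ≡ # S
  count-split {x} x∈U = begin
    countMem x S + countMem x S̅                     ≡⟨ cong (countMem x S +_) x∈U─A⇔x∉A ⟩
    countMem x S + count (∁? (x ∈?_)) (members S)   ≡⟨ count-complement (x ∈?_) (members S) ⟩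
    # S                                             ∎
    where
    open ≡-Reasoning
    x∈U─A⇔x∉A = count-map (x ∈?_) (∁? (x ∈?_)) (U ─_) (members S)
                  (λ {A} _ → mk⇔ (proj₂ ∘ x∈p─q⁻ U A) (x∈p∧x∉q⇒x∈p─q x∈U))

  ground : ∀ {x} → x ∈⋃ S̅ → x ∈ U
  ground {x} (C , C∈ , x∈C) with ∈-map⁻ (U ─_) C∈
  ... | A , _ , refl = proj₁ (x∈p─q⁻ U A x∈C)

  support : ∀ {x} → x ∈⋃ S̅ → x ∈⋃ S
  support x∈⋃S̅ = ⋃⁻ (members S) (ground x∈⋃S̅)

  union→intersection : UnionClosed S → IntersectionClosed S̅
  union→intersection closed = map-closed (U ─_) closed (de-morgan-∪ U)

  intersection→union : IntersectionClosed S → UnionClosed S̅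
  intersection→union closed = map-closed (U ─_) closed (de-morgan-∩ U)

  rare⇒common : ∀ {x} → x ∈⋃ S̅ → 2 * countMem x S̅ ≤ # S̅ → # S ≤ 2 * countMem x S
  rare⇒common {x} x∈ rare =
    Equivalence.to (half-complement {countMem x S̅} {countMem x S} (trans (+-comm (countMem x S̅) (countMem x S)) (count-split (ground x∈))))
      (subst (2 * countMem x S̅ ≤_) size rare)

  common⇒rare : ∀ {x} → x ∈⋃ S̅ → # S̅ ≤ 2 * countMem x S̅ → 2 * countMem x S ≤ # S
  common⇒rare {x} x∈ common =
    Equivalence.from (half-complement {countMem x S} {countMem x S̅} (count-split (ground x∈)))
      (subst (_≤ 2 * countMem x S̅) size common)

  -- With two members, one of them is a proper subset of U, so some complement is nonempty.
  nonempty-complement : 2 ≤ # S → ∃[ C ] (C ∈ₗ members S̅ × Nonempty C)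
  nonempty-complement #S≥2 with two-distinct (members S) (distinct S) #S≥2
  ... | A , B , A∈ , B∈ , A≢B with ≡-dec _≟ᵇ_ A U
  ...   | no A≢U = U ─ A , ∈-map⁺ (U ─_) A∈ , ─-nonempty U (⊆⋃ _ A∈) A≢U
  ...   | yes A≡U = U ─ B , ∈-map⁺ (U ─_) B∈ , ─-nonempty U (⊆⋃ _ B∈) (λ B≡U → A≢B (trans A≡U (sym B≡U)))

B⇒C : StmtB → StmtC
B⇒C hB u S closed (A , A∈ , y , y∈A) with 2 ≤? # S
-- With at most one member, the given element y lies in all of them.
... | no #S≱2 = y , (A , A∈ , y∈A) , ≤-trans (≤-pred (≰⇒> #S≱2)) (≤-trans y∈some (m≤m+n _ _))
  where y∈some = count-positive (y ∈?_) (members S) A∈ y∈A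
... | yes #S≥2 =
  let (x , x∈⋃S̅ , rare) = hB u S̅ (union→intersection closed) (subst (2 ≤_) (sym size) #S≥2)
  in x , support x∈⋃S̅ , rare⇒common x∈⋃S̅ rare
  where open Complements S

C⇒B : StmtC → StmtB
C⇒B hC u S closed #S≥2 =
  let (x , x∈⋃S̅ , common) = hC u S̅ (intersection→union closed) (nonempty-complement #S≥2)
  in x , support x∈⋃S̅ , common⇒rare x∈⋃S̅ common
  where open Complements S

-- Primes and prime powers

prime>1 : ∀ {p} → Prime p → 1 < p
prime>1 {p} pp = nonTrivial⇒n>1 p {{prime⇒nonTrivial pp}}

prime∣prime : ∀ {p r} → Prime p → Prime r → p ∣ r → p ≡ r
prime∣prime pp pr p∣r with prime⇒irreducible pr p∣r
... | inj₁ refl = contradiction pp ¬prime[1]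
... | inj₂ p≡r = p≡r

prime-divisor : ∀ n → 1 < n → ∃[ p ] (Prime p × p ∣ n)
prime-divisor n@(suc (suc _)) _ with factorise n
... | record { factors = p ∷ _ ; isFactorisation = n≡∏ ; factorsPrime = pp ∷ _ } =
  p , pp , subst (p ∣_) (sym n≡∏) (m∣m*n _)
prime-divisor 1 (s≤s ())

prime-power-cancel : ∀ {p t} → Prime p → ¬ p ∣ t → ∀ k m → p ^ k ∣ m * t → p ^ k ∣ m
prime-power-cancel pp p∤t zero m _ = 1∣ m
prime-power-cancel {p} {t} pp p∤t (suc k) m pᵏ⁺¹∣mt
  with euclidsLemma m t pp (∣-trans (m∣m*n (p ^ k)) pᵏ⁺¹∣mt)
... | inj₂ p∣t = contradiction p∣t p∤t
... | inj₁ (divides m′ refl) =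
  subst (p ^ suc k ∣_) (*-comm p m′) (*-monoʳ-∣ p (prime-power-cancel pp p∤t k m′ pᵏ∣m′t))
  where
  instance _ = prime⇒nonZero pp
  pᵏ∣m′t : p ^ k ∣ m′ * t
  pᵏ∣m′t = *-cancelˡ-∣ p (subst (p ^ suc k ∣_) (trans (cong (_* t) (*-comm m′ p)) (*-assoc p m′ t)) pᵏ⁺¹∣mt)

_∣ᵖ_ : ℕ → ℕ → Set
m ∣ᵖ n = ∀ {p} k → Prime p → p ^ k ∣ m → p ^ k ∣ n

∣ᵖ-cancel : ∀ {p m n} → Prime p → (m * p) ∣ᵖ (n * p) → m ∣ᵖ n
∣ᵖ-cancel {p} {m} {n} pp mp∣ᵖnp {r} k pr rᵏ∣m with r ≟ p
... | yes refl = *-cancelʳ-∣ r {{prime⇒nonZero pr}}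
                   (subst (_∣ n * r) (*-comm r (r ^ k)) (mp∣ᵖnp (suc k) pr (subst (_∣ m * r) (*-comm (r ^ k) r) (*-monoˡ-∣ r rᵏ∣m))))
... | no r≢p = prime-power-cancel pr (r≢p ∘ prime∣prime pr pp) k n (mp∣ᵖnp k pr (∣-trans rᵏ∣m (m∣m*n p)))

-- Prime-power separation: a nonzero m with m ∣ᵖ n divides n.
-- Strong induction on m: split off a prime factor p of m, which also divides n.
∣ᵖ⇒∣ : ∀ m {n} → .{{NonZero m}} → m ∣ᵖ n → m ∣ n
∣ᵖ⇒∣ = <-rec (λ m → ∀ {n} → .{{NonZero m}} → m ∣ᵖ n → m ∣ n) step
  where
  step : ∀ m → (∀ {m′} → m′ < m → ∀ {n} → .{{NonZero m′}} → m′ ∣ᵖ n → m′ ∣ n) →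
         ∀ {n} → .{{NonZero m}} → m ∣ᵖ n → m ∣ n
  step 1 _ {n} _ = 1∣ n
  step m@(suc (suc _)) rec {n} m∣ᵖn = subst₂ _∣_ (sym m≡m′p) (sym n≡n′p) (*-monoˡ-∣ p m′∣n′)
    where
    factor = prime-divisor m (s≤s (s≤s z≤n))
    p = proj₁ factor
    pp = proj₁ (proj₂ factor)
    p∣m = proj₂ (proj₂ factor)
    instance _ = prime⇒nonTrivial pp
    p∣n : p ∣ n
    p∣n = subst (_∣ n) (*-identityʳ p) (m∣ᵖn 1 pp (subst (_∣ m) (sym (*-identityʳ p)) p∣m))
    m′ = quotient p∣m
    n′ = quotient p∣n
    m≡m′p = m∣n⇒n≡quotient*m p∣m
    n≡n′p = m∣n⇒n≡quotient*m p∣n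
    instance _ = quotient≢0 p∣m
    m′∣n′ : m′ ∣ n′
    m′∣n′ = rec (quotient-< p∣m) (∣ᵖ-cancel pp (subst₂ _∣ᵖ_ m≡m′p n≡n′p m∣ᵖn))

-- A prime power dividing lcm m n divides m or n.
-- If p ∤ m, use lcm m n ∣ n * m; if p divides both, strip one factor p and recurse.
prime-power∣lcm : ∀ {p} → Prime p → ∀ k m n → p ^ k ∣ lcm m n → p ^ k ∣ m ⊎ p ^ k ∣ n
prime-power∣lcm pp zero m n _ = inj₁ (1∣ m)
prime-power∣lcm {p} pp (suc k) m n pᵏ⁺¹∣l with p ∣? m | p ∣? n
... | no p∤m | _ = inj₂ (prime-power-cancel pp p∤m (suc k) n (∣-trans pᵏ⁺¹∣l (lcm-least (n∣m*n n) (m∣m*n {n} m))))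
... | yes _ | no p∤n = inj₁ (prime-power-cancel pp p∤n (suc k) m (∣-trans pᵏ⁺¹∣l (lcm-least (m∣m*n {m} n) (n∣m*n m))))
... | yes (divides a refl) | yes (divides b refl) =
  Sum.map (times-p a) (times-p b) (prime-power∣lcm pp k a b pᵏ∣lcm[a,b])
  where
  instance _ = prime⇒nonZero pp
  times-p : ∀ c → p ^ k ∣ c → p ^ suc k ∣ c * p
  times-p c pᵏ∣c = subst (_∣ c * p) (*-comm (p ^ k) p) (*-monoˡ-∣ p pᵏ∣c)
  lcm[ap,bp]∣lcm[a,b]p : lcm (a * p) (b * p) ∣ lcm a b * p
  lcm[ap,bp]∣lcm[a,b]p = lcm-least (*-monoˡ-∣ p (m∣lcm[m,n] a b)) (*-monoˡ-∣ p (n∣lcm[m,n] a b))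
  pᵏ∣lcm[a,b] : p ^ k ∣ lcm a b
  pᵏ∣lcm[a,b] = *-cancelʳ-∣ p (subst (_∣ lcm a b * p) (*-comm p (p ^ k)) (∣-trans pᵏ⁺¹∣l lcm[ap,bp]∣lcm[a,b]p))

-- An injective sequence of primes

n∣n! : ∀ n → .{{NonZero n}} → n ∣ n !
n∣n! (suc n) = m∣m*n (n !)

-- Every prime divisor of n! + 1 exceeds n, since the primes up to n divide n!.
prime∣n!+1⇒> : ∀ {p} n → Prime p → p ∣ n ! + 1 → n < p
prime∣n!+1⇒> {p} n pp p∣n!+1 with p ≤? n
... | no p≰n = ≰⇒> p≰n
... | yes p≤n = contradiction (subst Prime (∣1⇒≡1 (∣m+n∣m⇒∣n p∣n!+1 p∣n!)) pp) ¬prime[1]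
  where
  instance _ = prime⇒nonZero pp
  p∣n! : p ∣ n !
  p∣n! = ∣-trans (n∣n! p) (m≤n⇒m!∣n! p≤n)

factor-of-n!+1 : ∀ n → ∃[ p ] (Prime p × p ∣ n ! + 1)
factor-of-n!+1 n = prime-divisor (n ! + 1) (+-monoˡ-≤ 1 (1≤n! n))

prime-above : ℕ → ℕ
prime-above n = proj₁ (factor-of-n!+1 n)

prime-above-prime : ∀ n → Prime (prime-above n)
prime-above-prime n = proj₁ (proj₂ (factor-of-n!+1 n))

prime-above-> : ∀ n → n < prime-above n
prime-above-> n = prime∣n!+1⇒> n (prime-above-prime n) (proj₂ (proj₂ (factor-of-n!+1 n)))

π : ℕ → ℕ
π zero = prime-above 0
π (suc j) = prime-above (π j)

π-prime : ∀ j → Prime (π j)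
π-prime zero = prime-above-prime 0
π-prime (suc j) = prime-above-prime (π j)

π-strictMono : ∀ {i j} → i < j → π i < π j
π-strictMono {i} {suc j} (s≤s i≤j) with m≤n⇒m<n∨m≡n i≤j
... | inj₁ i<j = <-trans (π-strictMono i<j) (prime-above-> (π j))
... | inj₂ refl = prime-above-> (π j)

π-injective : ∀ {i j} → π i ≡ π j → i ≡ j
π-injective {i} {j} πi≡πj with <-cmp i j
... | tri< i<j _ _ = contradiction πi≡πj (<⇒≢ (π-strictMono i<j))
... | tri≈ _ i≡j _ = i≡j
... | tri> _ _ j<i = contradiction (sym πi≡πj) (<⇒≢ (π-strictMono j<i))

-- Squarefree codes of subsets

code : ∀ {n} → (Fin n → ℕ) → Subset n → ℕ
code q [] = 1
code q (inside ∷ A) = q zero * code (q ∘ suc) A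
code q (outside ∷ A) = code (q ∘ suc) A

PrimeLabelling : ∀ {n} → (Fin n → ℕ) → Set
PrimeLabelling q = (∀ x → Prime (q x)) × (∀ {x y} → q x ≡ q y → x ≡ y)

tail-labelling : ∀ {n} {q : Fin (suc n) → ℕ} → PrimeLabelling q → PrimeLabelling (q ∘ suc)
tail-labelling (prime , injective) = prime ∘ suc , Fin.suc-injective ∘ injective

code-nonZero : ∀ {n} {q : Fin n → ℕ} → (∀ x → Prime (q x)) → ∀ A → NonZero (code q A)
code-nonZero prime [] = _
code-nonZero {q = q} prime (inside ∷ A) =
  m*n≢0 (q zero) _ {{prime⇒nonZero (prime zero)}} {{code-nonZero (prime ∘ suc) A}}
code-nonZero prime (outside ∷ A) = code-nonZero (prime ∘ suc) A

label∣code : ∀ {n} (q : Fin n → ℕ) {x} A → x ∈ A → q x ∣ code q A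
label∣code q (inside ∷ A) Vec.here = m∣m*n _
label∣code q (inside ∷ A) (Vec.there x∈A) = ∣n⇒∣m*n (q zero) (label∣code (q ∘ suc) A x∈A)
label∣code q (outside ∷ A) (Vec.there x∈A) = label∣code (q ∘ suc) A x∈A

prime∣code : ∀ {n} {q : Fin n → ℕ} → (∀ x → Prime (q x)) →
  ∀ {p} A → Prime p → p ∣ code q A → ∃[ x ] (x ∈ A × p ≡ q x)
prime∣code prime [] pp p∣1 = contradiction (subst Prime (∣1⇒≡1 p∣1) pp) ¬prime[1]
prime∣code {q = q} prime (inside ∷ A) pp p∣code with euclidsLemma (q zero) (code (q ∘ suc) A) pp p∣code
... | inj₁ p∣q₀ = zero , Vec.here , prime∣prime pp (prime zero) p∣q₀
... | inj₂ p∣rest = let (x , x∈A , p≡qx) = prime∣code (prime ∘ suc) A pp p∣rest in suc x , Vec.there x∈A , p≡qx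
prime∣code prime (outside ∷ A) pp p∣rest =
  let (x , x∈A , p≡qx) = prime∣code (prime ∘ suc) A pp p∣rest in suc x , Vec.there x∈A , p≡qx

code-squarefree : ∀ {n} {q : Fin n → ℕ} → PrimeLabelling q → ∀ {p} A → Prime p → ¬ p ^ 2 ∣ code q A
code-squarefree labelling {p} [] pp p²∣1 = contradiction (subst Prime (∣1⇒≡1 (∣-trans (m∣m*n (p ^ 1)) p²∣1)) pp) ¬prime[1]
code-squarefree labelling (outside ∷ A) pp p²∣rest = code-squarefree (tail-labelling labelling) A pp p²∣rest
code-squarefree {q = q} labelling@(prime , injective) {p} (inside ∷ A) pp p²∣code with p ≟ q zero
... | yes refl = let (x , _ , q₀≡qx) = prime∣code (prime ∘ suc) A pp p∣rest in Fin.0≢1+n (injective q₀≡qx)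
  where
  instance _ = prime⇒nonZero pp
  p∣rest : p ∣ code (q ∘ suc) A
  p∣rest = subst (_∣ code (q ∘ suc) A) (*-identityʳ p) (*-cancelˡ-∣ p p²∣code)
... | no p≢q₀ = code-squarefree (tail-labelling labelling) A pp
                  (prime-power-cancel pp (p≢q₀ ∘ prime∣prime pp (prime zero)) 2 _
                    (subst (p ^ 2 ∣_) (*-comm (q zero) _) p²∣code))

module Codes {n : ℕ} {q : Fin n → ℕ} (labelling : PrimeLabelling q) where

  private
    prime : ∀ x → Prime (q x)
    prime = proj₁ labelling
    injective : ∀ {x y} → q x ≡ q y → x ≡ y
    injective = proj₂ labelling

  prime-power∣code : ∀ {p} k A → Prime p → p ^ suc k ∣ code q A → k ≡ 0 × ∃[ x ] (x ∈ A × p ≡ q x)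
  prime-power∣code zero A pp p∣code = refl , prime∣code prime A pp (subst (_∣ code q A) (*-identityʳ _) p∣code)
  prime-power∣code {p} (suc k) A pp pᵏ⁺²∣code =
    contradiction (∣-trans (*-monoʳ-∣ p (*-monoʳ-∣ p (1∣ (p ^ k)))) pᵏ⁺²∣code) (code-squarefree labelling A pp)

  code-∣ : ∀ {m} A → (∀ {x} → x ∈ A → q x ∣ m) → code q A ∣ m
  code-∣ {m} A labels∣m = ∣ᵖ⇒∣ (code q A) {{code-nonZero prime A}} code∣ᵖm
    where
    code∣ᵖm : code q A ∣ᵖ m
    code∣ᵖm zero _ _ = 1∣ m
    code∣ᵖm (suc k) pp pᵏ⁺¹∣code with prime-power∣code k A pp pᵏ⁺¹∣code
    ... | refl , x , x∈A , refl = subst (_∣ m) (sym (*-identityʳ (q x))) (labels∣m x∈A)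

  -- Membership is divisibility by the label, so the code determines the subset.
  label∣code⇔∈ : ∀ {x} A → q x ∣ code q A ⇔ x ∈ A
  label∣code⇔∈ {x} A = mk⇔ ∈-from-∣ (label∣code q A)
    where
    ∈-from-∣ : q x ∣ code q A → x ∈ A
    ∈-from-∣ qx∣code with prime∣code prime A (prime x) qx∣code
    ... | y , y∈A , qx≡qy = subst (_∈ A) (sym (injective qx≡qy)) y∈A

  code-injective : ∀ {A B} → code q A ≡ code q B → A ≡ B
  code-injective {A} {B} eq = ⊆-antisym (transfer eq) (transfer (sym eq))
    where
    transfer : ∀ {A B} → code q A ≡ code q B → A ⊆ B
    transfer {A} {B} eq {x} x∈A = Equivalence.to (label∣code⇔∈ B) (subst (q x ∣_) eq (label∣code q A x∈A))

  -- Intersection becomes gcd: a prime power dividing both codes is a label of an element of both.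
  code-gcd : ∀ A B → gcd (code q A) (code q B) ≡ code q (A ∩ B)
  code-gcd A B = ∣-antisym (∣ᵖ⇒∣ _ {{gcd≢0}} gcd∣ᵖcode) (gcd-greatest (code-∣ (A ∩ B) inA) (code-∣ (A ∩ B) inB))
    where
    gcd≢0 = ≢-nonZero (gcd[m,n]≢0 (code q A) (code q B) (inj₁ (≢-nonZero⁻¹ (code q A) {{code-nonZero prime A}})))
    inA : ∀ {x} → x ∈ A ∩ B → q x ∣ code q A
    inA x∈ = label∣code q A (proj₁ (x∈p∩q⁻ A B x∈))
    inB : ∀ {x} → x ∈ A ∩ B → q x ∣ code q B
    inB x∈ = label∣code q B (proj₂ (x∈p∩q⁻ A B x∈))
    gcd∣ᵖcode : gcd (code q A) (code q B) ∣ᵖ code q (A ∩ B)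
    gcd∣ᵖcode zero _ _ = 1∣ _
    gcd∣ᵖcode (suc k) pp pᵏ⁺¹∣gcd
      with prime-power∣code k A pp (∣-trans pᵏ⁺¹∣gcd (gcd[m,n]∣m (code q A) (code q B)))
         | prime-power∣code k B pp (∣-trans pᵏ⁺¹∣gcd (gcd[m,n]∣n (code q A) (code q B)))
    ... | refl , x , x∈A , refl | _ , y , y∈B , qx≡qy =
      subst (_∣ code q (A ∩ B)) (sym (*-identityʳ (q x)))
        (label∣code q (A ∩ B) (x∈p∩q⁺ (x∈A , subst (_∈ B) (sym (injective qx≡qy)) y∈B)))

  code-lcm : ∀ A B → lcm (code q A) (code q B) ≡ code q (A ∪ B)
  code-lcm A B = ∣-antisym
    (lcm-least (code-∣ A (label∣code q (A ∪ B) ∘ x∈p∪q⁺ ∘ inj₁)) (code-∣ B (label∣code q (A ∪ B) ∘ x∈p∪q⁺ ∘ inj₂)))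
    (code-∣ (A ∪ B) λ x∈ → [ (λ x∈A → ∣-trans (label∣code q A x∈A) (m∣lcm[m,n] (code q A) (code q B)))
                           , (λ x∈B → ∣-trans (label∣code q B x∈B) (n∣lcm[m,n] (code q A) (code q B))) ] (x∈p∪q⁻ A B x∈))

module CodedFamily {u : ℕ} (S : Family u) where

  q : Fin u → ℕ
  q = π ∘ toℕ

  labelling : PrimeLabelling q
  labelling = π-prime ∘ toℕ , toℕ-injective ∘ π-injective

  open Codes labelling

  N : FinSetℕ⁺
  N = mkFinSetℕ⁺ (map (code q) (members S))
        (unique-map (code q) (λ _ _ → code-injective) (distinct S))
        (All.map⁺ (All.universal (code-nonZero (proj₁ labelling)) (members S)))

  size : length (elems N) ≡ # S
  size = length-map (code q) (members S)

  count-label : ∀ x → countDiv (q x) N ≡ countMem x S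
  count-label x = count-map (q x ∣?_) (x ∈?_) (code q) (members S) (λ {A} _ → label∣code⇔∈ A)

  gcd-closed : IntersectionClosed S → GCDClosed N
  gcd-closed closed = map-closed (code q) closed code-gcd

  lcm-closed : UnionClosed S → LCMClosed N
  lcm-closed closed = map-closed (code q) closed code-lcm

  -- The code of a nonempty member is divisible by a prime, so differs from 1.
  nontrivial-member : ∀ {A} → A ∈ₗ members S → Nonempty A → ∃[ n ] (n ∈ₗ elems N × n ≢ 1)
  nontrivial-member {A} A∈ (x , x∈A) = code q A , ∈-map⁺ (code q) A∈ , code≢1
    where
    code≢1 : code q A ≢ 1
    code≢1 code≡1 = ¬prime[1] (subst Prime (∣1⇒≡1 (subst (q x ∣_) code≡1 (label∣code q A x∈A))) (π-prime (toℕ x)))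

  -- A rarely dividing prime power p^k of a member of N is a label p = q x (with k = 1),
  -- and x is then a rare element of S.
  rare-prime-power : ∀ {p k n} → Prime p → 1 ≤ k → n ∈ₗ elems N → p ^ k ∣ n →
    2 * countDiv (p ^ k) N ≤ length (elems N) → ∃[ x ] (x ∈⋃ S × 2 * countMem x S ≤ # S)
  rare-prime-power {p} {suc k} pp _ n∈ pᵏ∣n rare with ∈-map⁻ (code q) n∈
  ... | A , A∈ , refl with prime-power∣code k A pp pᵏ∣n
  ...   | refl , x , x∈A , refl = x , (A , A∈ , x∈A) , subst₂ (λ c m → 2 * c ≤ m) p¹-count size rare
    where
    p¹-count : countDiv (q x ^ 1) N ≡ countMem x S
    p¹-count = trans (cong (λ d → countDiv d N) (*-identityʳ (q x))) (count-label x)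

  -- A frequent divisor d > 1 has a prime factor, which is a label q x of an element of a
  -- member; q x divides whatever d divides, so x is a frequent element of S.
  frequent-divisor : ∀ {d} → 1 ≤ # S → 1 < d →
    length (elems N) ≤ 2 * countDiv d N → ∃[ x ] (x ∈⋃ S × # S ≤ 2 * countMem x S)
  frequent-divisor {d} #S≥1 d>1 frequent
    with count-witness (d ∣?_) (elems N) (half-positive (subst (1 ≤_) (sym size) #S≥1) frequent)
  ... | n , n∈ , d∣n with ∈-map⁻ (code q) n∈ | prime-divisor d d>1
  ...   | A , A∈ , refl | p , pp , p∣d with prime∣code (proj₁ labelling) A pp (∣-trans p∣d d∣n)
  ...     | x , x∈A , refl = x , (A , A∈ , x∈A) , (begin
    # S                 ≡⟨ size ⟨
    length (elems N)    ≤⟨ frequent ⟩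
    2 * countDiv d N    ≤⟨ *-monoʳ-≤ 2 (count-mono (d ∣?_) (q x ∣?_) (elems N) (λ _ → ∣-trans p∣d)) ⟩
    2 * countDiv (q x) N ≡⟨ cong (2 *_) (count-label x) ⟩
    2 * countMem x S    ∎)
    where open ≤-Reasoning

A⇒B : StmtA → StmtB
A⇒B hA u S closed #S≥2 =
  let (p , k , pp , k≥1 , (n , n∈ , pᵏ∣n) , rare) = hA N (gcd-closed closed) (subst (2 ≤_) (sym size) #S≥2)
  in rare-prime-power pp k≥1 n∈ pᵏ∣n rare
  where open CodedFamily S

D⇒C : StmtD → StmtC
D⇒C hD u S closed (A , A∈ , nonempty) =
  let (d , d>1 , frequent) = hD N (lcm-closed closed) (nontrivial-member A∈ nonempty)
  in frequent-divisor (member⇒1≤length A∈) d>1 frequent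
  where open CodedFamily S

-- Prime-power divisors

IsPrimePower : ℕ → Set
IsPrimePower d = ∃[ p ] ∃[ k ] (Prime p × p ^ suc k ≡ d)

prime-power>1 : ∀ {d} → IsPrimePower d → 1 < d
prime-power>1 (p , k , pp , refl) = <-≤-trans (prime>1 pp) (m≤m*n p (p ^ k) {{m^n≢0 p k {{prime⇒nonZero pp}}}})

exponent<power : ∀ {p} → 1 < p → ∀ k → k < p ^ k
exponent<power p>1 zero = s≤s z≤n
exponent<power {p@(suc _)} p>1 (suc k) =
  ≤-trans (s≤s (exponent<power p>1 k)) (subst (suc (p ^ k) ≤_) (*-comm (p ^ k) p) (m<m*n (p ^ k) p {{m^n≢0 p k}} p>1))

-- Base and exponent of a prime power are below it, so being a prime power is decidable.
isPrimePower? : Decidable IsPrimePower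
isPrimePower? d =
  map′ unbound bound (anyUpTo? (λ p → anyUpTo? (λ k → prime? p ×-dec p ^ suc k ≟ d) d) (suc d))
  where
  unbound : ∃[ p ] (p < suc d × ∃[ k ] (k < d × Prime p × p ^ suc k ≡ d)) → IsPrimePower d
  unbound (p , _ , k , _ , pp , pᵏ⁺¹≡d) = p , k , pp , pᵏ⁺¹≡d
  bound : IsPrimePower d → ∃[ p ] (p < suc d × ∃[ k ] (k < d × Prime p × p ^ suc k ≡ d))
  bound (p , k , pp , refl) = p , s≤s (m≤m*n p (p ^ k)) , k , k<pᵏ⁺¹ , pp , refl
    where
    instance _ = prime⇒nonZero pp
    instance _ = m^n≢0 p k
    k<pᵏ⁺¹ : k < p ^ suc k
    k<pᵏ⁺¹ = <-≤-trans (exponent<power (prime>1 pp) k) (m≤n*m (p ^ k) p)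

subset : ∀ {n} {P : Pred (Fin n) ℓ} → Decidable P → Subset n
subset {n = zero} P? = []
subset {n = suc n} P? = does (P? zero) ∷ subset (P? ∘ suc)

∈-subset : ∀ {n} {P : Pred (Fin n) ℓ} (P? : Decidable P) {x} → x ∈ subset P? ⇔ P x
∈-subset P? = mk⇔ (subset⁻ P?) (subset⁺ P?)
  where
  subset⁻ : ∀ {n} {P : Pred (Fin n) ℓ} (P? : Decidable P) {x} → x ∈ subset P? → P x
  subset⁻ P? {x = zero} x∈ with P? zero | x∈
  ... | yes Px | _ = Px
  subset⁻ P? {x = suc x} (Vec.there x∈) = subset⁻ (P? ∘ suc) x∈
  subset⁺ : ∀ {n} {P : Pred (Fin n) ℓ} (P? : Decidable P) {x} → P x → x ∈ subset P?
  subset⁺ P? {x = zero} Px with P? zero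
  ... | yes _ = Vec.here
  ... | no ¬Px = contradiction Px ¬Px
  subset⁺ P? {x = suc x} Px = Vec.there (subset⁺ (P? ∘ suc) Px)

primePowerDivisors : ∀ u → ℕ → Subset u
primePowerDivisors u n = subset (λ (x : Fin u) → isPrimePower? (toℕ x) ×-dec toℕ x ∣? n)

module _ {u : ℕ} where

  private
    D : ℕ → Subset u
    D = primePowerDivisors u

  ∈D⇔ : ∀ {x n} → x ∈ D n ⇔ (IsPrimePower (toℕ x) × toℕ x ∣ n)
  ∈D⇔ = ∈-subset _

  primePowerDivisors-gcd : ∀ m n → D m ∩ D n ≡ D (gcd m n)
  primePowerDivisors-gcd m n = ⊆-antisym sub sup
    where
    sub : D m ∩ D n ⊆ D (gcd m n)
    sub x∈ with x∈p∩q⁻ (D m) (D n) x∈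
    ... | x∈Dm , x∈Dn with Equivalence.to ∈D⇔ x∈Dm | Equivalence.to ∈D⇔ x∈Dn
    ...   | ppx , x∣m | _ , x∣n = Equivalence.from ∈D⇔ (ppx , gcd-greatest x∣m x∣n)
    sup : D (gcd m n) ⊆ D m ∩ D n
    sup x∈ with Equivalence.to ∈D⇔ x∈
    ... | ppx , x∣gcd = x∈p∩q⁺ ( Equivalence.from ∈D⇔ (ppx , ∣-trans x∣gcd (gcd[m,n]∣m m n))
                               , Equivalence.from ∈D⇔ (ppx , ∣-trans x∣gcd (gcd[m,n]∣n m n)))

  -- The union case uses that a prime power dividing lcm m n divides m or n.
  primePowerDivisors-lcm : ∀ m n → D m ∪ D n ≡ D (lcm m n)
  primePowerDivisors-lcm m n = ⊆-antisym sub sup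
    where
    sub : D m ∪ D n ⊆ D (lcm m n)
    sub x∈ with x∈p∪q⁻ (D m) (D n) x∈
    ... | inj₁ x∈Dm = let (ppx , x∣m) = Equivalence.to ∈D⇔ x∈Dm in
                      Equivalence.from ∈D⇔ (ppx , ∣-trans x∣m (m∣lcm[m,n] m n))
    ... | inj₂ x∈Dn = let (ppx , x∣n) = Equivalence.to ∈D⇔ x∈Dn in
                      Equivalence.from ∈D⇔ (ppx , ∣-trans x∣n (n∣lcm[m,n] m n))
    sup : D (lcm m n) ⊆ D m ∪ D n
    sup {x} x∈ with Equivalence.to ∈D⇔ x∈
    ... | ppx@(p , k , pp , pᵏ⁺¹≡x) , x∣lcm with prime-power∣lcm pp (suc k) m n (subst (_∣ lcm m n) (sym pᵏ⁺¹≡x) x∣lcm)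
    ...   | inj₁ pᵏ⁺¹∣m = x∈p∪q⁺ (inj₁ (Equivalence.from ∈D⇔ (ppx , subst (_∣ m) pᵏ⁺¹≡x pᵏ⁺¹∣m)))
    ...   | inj₂ pᵏ⁺¹∣n = x∈p∪q⁺ (inj₂ (Equivalence.from ∈D⇔ (ppx , subst (_∣ n) pᵏ⁺¹≡x pᵏ⁺¹∣n)))

  -- For nonzero m < u, D m determines m up to divisibility (prime-power separation).
  primePowerDivisors-∣ : ∀ {m n} → .{{NonZero m}} → m < u → D m ⊆ D n → m ∣ n
  primePowerDivisors-∣ {m} {n} m<u Dm⊆Dn = ∣ᵖ⇒∣ m m∣ᵖn
    where
    m∣ᵖn : m ∣ᵖ n
    m∣ᵖn zero _ _ = 1∣ n
    m∣ᵖn {p} (suc k) pp pᵏ⁺¹∣m = subst (_∣ n) x≡pᵏ⁺¹ (proj₂ (Equivalence.to ∈D⇔ (Dm⊆Dn x∈Dm)))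
      where
      x : Fin u
      x = fromℕ< (≤-<-trans (∣⇒≤ pᵏ⁺¹∣m) m<u)
      x≡pᵏ⁺¹ : toℕ x ≡ p ^ suc k
      x≡pᵏ⁺¹ = toℕ-fromℕ< _
      x∈Dm : x ∈ D m
      x∈Dm = Equivalence.from ∈D⇔ ((p , k , pp , sym x≡pᵏ⁺¹) , subst (_∣ m) (sym x≡pᵏ⁺¹) pᵏ⁺¹∣m)

  primePowerDivisors-injective : ∀ {m n} → .{{NonZero m}} → .{{NonZero n}} → m < u → n < u → D m ≡ D n → m ≡ n
  primePowerDivisors-injective m<u n<u Dm≡Dn =
    ∣-antisym (primePowerDivisors-∣ m<u (subst (_ ∈_) Dm≡Dn)) (primePowerDivisors-∣ n<u (subst (_ ∈_) (sym Dm≡Dn)))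

-- A finite set N of positive integers, encoded as the family of the sets of prime-power
-- divisors of its members, inside Fin u with u = 1 + ∏ N (every such divisor is at most ∏ N).
module PrimePowerFamily (N : FinSetℕ⁺) where

  u : ℕ
  u = suc (product (elems N))

  encode : ℕ → Subset u
  encode = primePowerDivisors u

  private
    nonZero : ∀ {n} → n ∈ₗ elems N → NonZero n
    nonZero = All.lookup (positive N)

    below : ∀ {d n} → n ∈ₗ elems N → d ∣ n → d < u
    below n∈ d∣n = s≤s (∣⇒≤ {{product≢0 (positive N)}} (∣-trans d∣n (∈⇒∣product n∈)))

  S : Family u
  S = mkFamily (map encode (elems N)) (unique-map encode injective (unique N))
    where
    injective : ∀ {m n} → m ∈ₗ elems N → n ∈ₗ elems N → encode m ≡ encode n → m ≡ n
    injective m∈ n∈ = primePowerDivisors-injective {{nonZero m∈}} {{nonZero n∈}} (below m∈ ∣-refl) (below n∈ ∣-refl)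

  size : # S ≡ length (elems N)
  size = length-map encode (elems N)

  count-prime-power : ∀ {x} → IsPrimePower (toℕ x) → countMem x S ≡ countDiv (toℕ x) N
  count-prime-power {x} ppx = count-map (x ∈?_) (toℕ x ∣?_) encode (elems N)
    (λ _ → mk⇔ (proj₂ ∘ Equivalence.to ∈D⇔) (λ x∣n → Equivalence.from ∈D⇔ (ppx , x∣n)))

  intersection-closed : GCDClosed N → IntersectionClosed S
  intersection-closed closed = map-closed encode {gcd} {_∩_} closed primePowerDivisors-gcd

  union-closed : LCMClosed N → UnionClosed S
  union-closed closed = map-closed encode {lcm} {_∪_} closed primePowerDivisors-lcm

  -- A member n ≠ 1 has a prime divisor, which lies in encode n.
  nonempty-member : ∀ {n} → n ∈ₗ elems N → n ≢ 1 → ∃[ A ] (A ∈ₗ members S × Nonempty A)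
  nonempty-member {n} n∈ n≢1 with prime-divisor n (≤∧≢⇒< (>-nonZero⁻¹ n {{nonZero n∈}}) (n≢1 ∘ sym))
  ... | p , pp , p∣n = encode n , ∈-map⁺ encode n∈ , fromℕ< p<u , Equivalence.from ∈D⇔ (ppp , subst (_∣ n) (sym x≡p) p∣n)
    where
    p<u = below n∈ p∣n
    x≡p : toℕ (fromℕ< p<u) ≡ p
    x≡p = toℕ-fromℕ< p<u
    ppp : IsPrimePower (toℕ (fromℕ< p<u))
    ppp = p , 0 , pp , trans (*-identityʳ p) (sym x≡p)

  rare-element : ∀ {x} → x ∈⋃ S → 2 * countMem x S ≤ # S →
    ∃[ p ] ∃[ k ] (Prime p × 1 ≤ k × (∃[ n ] (n ∈ₗ elems N × p ^ k ∣ n)) × 2 * countDiv (p ^ k) N ≤ length (elems N))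
  rare-element {x} (A , A∈ , x∈A) rare with ∈-map⁻ encode A∈
  ... | n , n∈ , refl with Equivalence.to ∈D⇔ x∈A
  ...   | ppx@(p , k , pp , pᵏ⁺¹≡x) , x∣n =
    p , suc k , pp , s≤s z≤n , (n , n∈ , subst (_∣ n) (sym pᵏ⁺¹≡x) x∣n) , subst₂ (λ c m → 2 * c ≤ m) count≡ size rare
    where
    count≡ : countMem x S ≡ countDiv (p ^ suc k) N
    count≡ = trans (count-prime-power ppx) (cong (λ d → countDiv d N) (sym pᵏ⁺¹≡x))

  frequent-element : ∀ {x} → x ∈⋃ S → # S ≤ 2 * countMem x S →
    ∃[ d ] (1 < d × length (elems N) ≤ 2 * countDiv d N)
  frequent-element {x} (A , A∈ , x∈A) frequent with ∈-map⁻ encode A∈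
  ... | n , n∈ , refl with Equivalence.to ∈D⇔ x∈A
  ...   | ppx , _ = toℕ x , prime-power>1 ppx , subst₂ (λ m c → m ≤ 2 * c) size (count-prime-power ppx) frequent

B⇒A : StmtB → StmtA
B⇒A hB N closed |N|≥2 =
  let (x , x∈⋃S , rare) = hB u S (intersection-closed closed) (subst (2 ≤_) (sym size) |N|≥2)
  in rare-element x∈⋃S rare
  where open PrimePowerFamily N

C⇒D : StmtC → StmtD
C⇒D hC N closed (n , n∈ , n≢1) =
  let (x , x∈⋃S , frequent) = hC u S (union-closed closed) (nonempty-member n∈ n≢1)
  in frequent-element x∈⋃S frequent
  where open PrimePowerFamily N

corollary2 : (StmtA ⇔ StmtB) × (StmtA ⇔ StmtC) × (StmtA ⇔ StmtD) × (StmtB ⇔ StmtC) × (StmtB ⇔ StmtD) × (StmtC ⇔ StmtD)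
corollary2 = A⇔B , A⇔C , A⇔D , B⇔C , B⇔D , C⇔D
  where
  A⇔B = mk⇔ A⇒B B⇒A
  B⇔C = mk⇔ B⇒C C⇒B
  C⇔D = mk⇔ C⇒D D⇒C
  A⇔C = mk⇔ (B⇒C ∘ A⇒B) (B⇒A ∘ C⇒B)
  B⇔D = mk⇔ (C⇒D ∘ B⇒C) (C⇒B ∘ D⇒C)
  A⇔D = mk⇔ (C⇒D ∘ B⇒C ∘ A⇒B) (B⇒A ∘ C⇒B ∘ D⇒C)
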